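{- Let $G$ be an $(n-3)$-regular graph of order $n\ge 7$ that is not the complete multipartite graph $K_{3,3,\ldots,3}$ (all parts of size $3$), and let $B$ be a Roman bondage set of $G$. Let $x,w\in V(G)$ with $xw\in E(G)$; let $y,z$ be the only two vertices (other than $x$) not adjacent to $x$, and $p,q$ the only two vertices (other than $w$) not adjacent to $w$ in $G$. If $E_G(x)\cap B=\{xw\}$ and $\{y,z\}\cap\{p,q\}\neq\emptyset$, then $|B|\ge n-2$.
   Context: All graphs are finite, simple and undirected. For a vertex $x$, $E_G(x)$ denotes the set of edges of $G$ incident with $x$. A Roman dominating function on $G=(V,E)$ is a function $f:V\to\{0,1,2\}$ such that every vertex $u$ with $f(u)=0$ is adjacent to some vertex $v$ with $f(v)=2$; its weight is $\sum_{u\in V}f(u)$, and $\gamma_{\rm R}(G)$ is the minimum weight of a Roman dominating function on $G$. A Roman bondage set of $G$ is a set $B\subseteq E(G)$ with $\gamma_{\rm R}(G-B)>\gamma_{\rm R}(G)$. -}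

module Defs where

open import Data.Nat using (ℕ; zero; suc; _+_; _≤_; _<_; _<ᵇ_)
open import Data.Bool using (Bool; true; false; _∧_; not; if_then_else_)
open import Data.Fin using (Fin; toℕ)
open import Data.List using (List; map; allFin; filter; length)
open import Data.Nat.ListAction using (sum)
open import Data.Product using (Σ; _×_; ∃)
open import Relation.Binary.PropositionalEquality using (_≡_; _≢_)

record Graph (n : ℕ) : Set where
  field
    adj   : Fin n → Fin n → Bool
    sym   : ∀ i j → adj i j ≡ adj j i
    irrefl : ∀ i → adj i i ≡ false
open Graph public

count : ∀ {n} → (Fin n → Bool) → ℕ
count {n} p = sum (map (λ i → if p i then 1 else 0) (allFin n))

degree : ∀ {n} → Graph n → Fin n → ℕ
degree G v = count (adj G v)

Regular : ∀ {n} → Graph n → ℕ → Set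
Regular G r = ∀ v → degree G v ≡ r

IsK333 : ∀ {n} → Graph n → Set
IsK333 {n} G =
  Σ (Fin n → ℕ) λ part →
    (∀ v → count (λ u → Data.Nat._≡ᵇ_ (part u) (part v)) ≡ 3) ×
    (∀ u v → (adj G u v ≡ true → part u ≢ part v) ×
             (part u ≢ part v → adj G u v ≡ true))

record EdgeSet {n : ℕ} (G : Graph n) : Set where
  field
    mem    : Fin n → Fin n → Bool
    msym   : ∀ i j → mem i j ≡ mem j i
    sub    : ∀ i j → mem i j ≡ true → adj G i j ≡ true
open EdgeSet public

card : ∀ {n} {G : Graph n} → EdgeSet G → ℕ
card {n} B = sum (map (λ i → count (λ j → (toℕ i <ᵇ toℕ j) ∧ mem B i j)) (allFin n))

_⊖_ : ∀ {n} (G : Graph n) → EdgeSet G → Graph n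
_⊖_ {n} G B = record
  { adj = λ i j → adj G i j ∧ not (mem B i j)
  ; sym = λ i j → Relation.Binary.PropositionalEquality.cong₂ (λ a b → a ∧ not b) (sym G i j) (msym B i j)
  ; irrefl = λ i → Relation.Binary.PropositionalEquality.cong (λ a → a ∧ not (mem B i i)) (irrefl G i)
  }

IsRDF : ∀ {n} → Graph n → (Fin n → ℕ) → Set
IsRDF {n} G f =
  (∀ v → f v ≤ 2) ×
  (∀ u → f u ≡ 0 → Σ (Fin n) λ v → (adj G u v ≡ true) × (f v ≡ 2))

weight : ∀ {n} → (Fin n → ℕ) → ℕ
weight {n} f = sum (map f (allFin n))

IsγR : ∀ {n} → Graph n → ℕ → Set
IsγR G k = (Σ _ λ f → IsRDF G f × weight f ≡ k) × (∀ f → IsRDF G f → k ≤ weight f)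

IsRomanBondage : ∀ {n} (G : Graph n) → EdgeSet G → Set
IsRomanBondage G B = Σ ℕ λ k → IsγR G k × (∀ g → IsRDF (G ⊖ B) g → k < weight g)

module Submission where

-- Every vertex of G has exactly two non-neighbours, and γR(G) ≥ 4, so G − B has no Roman
-- dominating function of weight 4. Hence every vertex meets B, and any two vertices have a
-- common non-neighbour in G − B.
--
-- Rank the vertices: y and w lowest, x and z next, all others above. Counting each edge of B at
-- its higher endpoint shows |B| ≥ n − 2 as soon as every vertex except y and w has a B-edge
-- going down, or every vertex except y, w and one more does and some vertex has two. The vertex
-- x has xw. Every other vertex u has a B-edge to y, z or w, because the common non-neighbour of
-- x and u in G − B lies in {y, z, w}; this can fail only at z when q = z, and at the second
-- non-neighbour t of z when q ≠ z (t and q are then ranked on top). In the remaining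
-- configurations a chase through non-neighbourhoods, driven by the common-non-neighbour
-- property, yields a vertex with two B-edges going down.

open import Defs hiding (sym)
open import Data.Nat using (ℕ; zero; suc; _+_; _*_; _≤_; _<_; _∸_; _<ᵇ_; z≤n; s≤s)
open import Data.Nat.Properties
open import Data.Bool using (Bool; true; false; _∧_; not; if_then_else_; T)
open import Data.Bool.Properties using (∧-zeroʳ; ¬-not; not-injective) renaming (_≟_ to _≟ᵇ_)
open import Data.Fin using (Fin; toℕ) renaming (zero to fzero; suc to fsuc)
open import Data.Fin.Properties using (toℕ-injective; toℕ<n; any?) renaming (_≟_ to _≟ᶠ_)
open import Data.List using (List; []; _∷_; map; allFin; length; tabulate)
open import Data.List.Properties using (map-tabulate)
open import Data.List.Membership.Propositional using (_∈_; _∉_)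
import Data.List.Membership.DecPropositional as DecMembership
open import Data.List.Relation.Unary.Any using (here; there)
open import Data.List.Relation.Unary.All as All using (All; lookup)
open import Data.List.Relation.Unary.Unique.Propositional using (Unique)
open import Data.List.Relation.Unary.AllPairs using ([]; _∷_)
open import Data.Nat.ListAction using (sum)
open import Data.Vec.Functional using (updateAt)
open import Data.Vec.Functional.Properties using (updateAt-updates; updateAt-minimal)
open import Algebra.Properties.CommutativeMonoid.Sum +-0-commutativeMonoid
  using (sum-cong-≗; ∑-distrib-+; ∑-comm) renaming (sum to ∑)
open import Algebra.Properties.CommutativeSemigroup +-commutativeSemigroup using (x∙yz≈y∙xz)
open import Data.Product using (Σ; ∃; _×_; _,_; proj₁; proj₂; map₂)
open import Data.Sum using (_⊎_; inj₁; inj₂)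
open import Data.Empty using (⊥; ⊥-elim)
open import Function using (_∘_; case_of_)
open import Relation.Nullary using (¬_; Dec; yes; no; does; ¬?; _×-dec_)
open import Relation.Nullary.Negation using (contradiction)
open import Relation.Nullary.Decidable using (dec-true; dec-false; decidable-stable)
open import Relation.Binary.PropositionalEquality
open import Relation.Binary.Definitions using (tri<; tri≈; tri>)

infix 4 _∈?_
_∈?_ : ∀ {n} (i : Fin n) (as : List (Fin n)) → Dec (i ∈ as)
_∈?_ = DecMembership._∈?_ _≟ᶠ_

𝟙 : Bool → ℕ
𝟙 b = if b then 1 else 0

∑-mono-≤ : ∀ {n} {f g : Fin n → ℕ} → (∀ i → f i ≤ g i) → ∑ f ≤ ∑ g
∑-mono-≤ {zero}  f≤g = z≤n
∑-mono-≤ {suc n} f≤g = +-mono-≤ (f≤g fzero) (∑-mono-≤ (f≤g ∘ fsuc))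

∑-const : ∀ n c → ∑ {n} (λ _ → c) ≡ n * c
∑-const zero    c = refl
∑-const (suc n) c = cong (c +_) (∑-const n c)

sum-map-allFin : ∀ {n} (f : Fin n → ℕ) → sum (map f (allFin n)) ≡ ∑ f
sum-map-allFin {n} f = trans (cong sum (map-tabulate (λ i → i) f)) (sum-tabulate f)
  where
  sum-tabulate : ∀ {m} (g : Fin m → ℕ) → sum (tabulate g) ≡ ∑ g
  sum-tabulate {zero}  g = refl
  sum-tabulate {suc m} g = cong (g fzero +_) (sum-tabulate (g ∘ fsuc))

count≡∑ : ∀ {n} (p : Fin n → Bool) → count p ≡ ∑ (𝟙 ∘ p)
count≡∑ p = sum-map-allFin (𝟙 ∘ p)

zeroAt : ∀ {n} → Fin n → (Fin n → ℕ) → Fin n → ℕ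
zeroAt a f = updateAt f a (λ _ → 0)

∑-zeroAt : ∀ {n} (f : Fin n → ℕ) a → ∑ f ≡ f a + ∑ (zeroAt a f)
∑-zeroAt f fzero    = refl
∑-zeroAt f (fsuc a) = begin
  f fzero + ∑ (f ∘ fsuc)                              ≡⟨ cong (f fzero +_) (∑-zeroAt (f ∘ fsuc) a) ⟩
  f fzero + (f (fsuc a) + ∑ (zeroAt a (f ∘ fsuc)))    ≡⟨ x∙yz≈y∙xz (f fzero) (f (fsuc a)) _ ⟩
  f (fsuc a) + (f fzero + ∑ (zeroAt a (f ∘ fsuc)))    ∎
  where open ≡-Reasoning

zeroAt-≤ : ∀ {n} (a : Fin n) (f : Fin n → ℕ) i → zeroAt a f i ≤ f i
zeroAt-≤ a f i with i ≟ᶠ a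
... | yes refl = subst (_≤ f i) (sym (updateAt-updates i f)) z≤n
... | no i≢a   = ≤-reflexive (updateAt-minimal i a f i≢a)

zeroAt-vanishes : ∀ {n} {f : Fin n → ℕ} {a as} → (∀ i → i ∉ a ∷ as → f i ≡ 0) → ∀ i → i ∉ as → zeroAt a f i ≡ 0
zeroAt-vanishes {f = f} {a} vanish i i∉as with i ≟ᶠ a
... | yes refl = updateAt-updates i f
... | no i≢a   = trans (updateAt-minimal i a f i≢a) (vanish i λ { (here i≡a) → i≢a i≡a ; (there i∈as) → i∉as i∈as })

∑-≤-length* : ∀ {n} {f : Fin n → ℕ} {m} (as : List (Fin n)) →
  (∀ i → f i ≤ m) → (∀ i → i ∉ as → f i ≡ 0) → ∑ f ≤ length as * m
∑-≤-length* {n} {f} []       f≤m vanish =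
  ≤-trans (∑-mono-≤ (λ i → ≤-reflexive (vanish i λ ()))) (≤-reflexive (trans (∑-const n 0) (*-zeroʳ n)))
∑-≤-length* {f = f} (a ∷ as) f≤m vanish = begin
  ∑ f                       ≡⟨ ∑-zeroAt f a ⟩
  f a + ∑ (zeroAt a f)      ≤⟨ +-mono-≤ (f≤m a) (∑-≤-length* as (λ i → ≤-trans (zeroAt-≤ a f i) (f≤m i))
                                                                (zeroAt-vanishes vanish)) ⟩
  length (a ∷ as) * _       ∎
  where open ≤-Reasoning

length*≤∑ : ∀ {n} {f : Fin n → ℕ} {m} {as : List (Fin n)} →
  Unique as → (∀ i → i ∈ as → m ≤ f i) → length as * m ≤ ∑ f
length*≤∑ {as = []}                  _              _     = z≤n
length*≤∑ {f = f} {m} {as = a ∷ as} (a∉as ∷ unique) m≤f = begin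
  m + length as * m         ≤⟨ +-mono-≤ (m≤f a (here refl)) (length*≤∑ unique m≤zeroAt) ⟩
  f a + ∑ (zeroAt a f)      ≡⟨ sym (∑-zeroAt f a) ⟩
  ∑ f                       ∎
  where
  open ≤-Reasoning
  m≤zeroAt : ∀ i → i ∈ as → m ≤ zeroAt a f i
  m≤zeroAt i i∈as = subst (m ≤_) (sym (updateAt-minimal i a f (λ i≡a → lookup a∉as i∈as (sym i≡a))))
                          (m≤f i (there i∈as))

count-≤-length : ∀ {n} (p : Fin n → Bool) (as : List (Fin n)) → (∀ i → p i ≡ true → i ∈ as) → count p ≤ length as
count-≤-length p as p⊆as = begin
  count p        ≡⟨ count≡∑ p ⟩
  ∑ (𝟙 ∘ p)      ≤⟨ ∑-≤-length* as 𝟙≤1 outside ⟩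
  length as * 1  ≡⟨ *-identityʳ (length as) ⟩
  length as      ∎
  where
  open ≤-Reasoning
  𝟙≤1 : ∀ i → 𝟙 (p i) ≤ 1
  𝟙≤1 i with p i
  ... | true  = ≤-refl
  ... | false = z≤n
  outside : ∀ i → i ∉ as → 𝟙 (p i) ≡ 0
  outside i i∉as with p i in pi
  ... | true  = contradiction (p⊆as i pi) i∉as
  ... | false = refl

length-≤-count : ∀ {n} (p : Fin n → Bool) {as : List (Fin n)} → Unique as → (∀ i → i ∈ as → p i ≡ true) →
  length as ≤ count p
length-≤-count p {as} unique as⊆p = begin
  length as      ≡⟨ sym (*-identityʳ (length as)) ⟩
  length as * 1  ≤⟨ length*≤∑ unique (λ i i∈as → ≤-reflexive (cong 𝟙 (sym (as⊆p i i∈as)))) ⟩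
  ∑ (𝟙 ∘ p)      ≡⟨ sym (count≡∑ p) ⟩
  count p        ∎
  where open ≤-Reasoning

count-complement : ∀ {n} (p : Fin n → Bool) → count p + count (not ∘ p) ≡ n
count-complement {n} p = begin
  count p + count (not ∘ p)          ≡⟨ cong₂ _+_ (count≡∑ p) (count≡∑ (not ∘ p)) ⟩
  ∑ (𝟙 ∘ p) + ∑ (𝟙 ∘ not ∘ p)        ≡⟨ sym (∑-distrib-+ (𝟙 ∘ p) (𝟙 ∘ not ∘ p)) ⟩
  ∑ (λ i → 𝟙 (p i) + 𝟙 (not (p i)))  ≡⟨ sum-cong-≗ (𝟙-+-not ∘ p) ⟩
  ∑ {n} (λ _ → 1)                    ≡⟨ trans (∑-const n 1) (*-identityʳ n) ⟩
  n                                  ∎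
  where
  open ≡-Reasoning
  𝟙-+-not : ∀ b → 𝟙 b + 𝟙 (not b) ≡ 1
  𝟙-+-not true  = refl
  𝟙-+-not false = refl

count-witness : ∀ {n} (p : Fin n → Bool) (as : List (Fin n)) → length as < count p → ∃ λ i → p i ≡ true × i ∉ as
count-witness {n} p as as<p with any? (λ i → p i ≟ᵇ true ×-dec ¬? (i ∈? as))
... | yes witness = witness
... | no ¬witness = contradiction (count-≤-length p as p⊆as) (<⇒≱ as<p)
  where
  p⊆as : ∀ i → p i ≡ true → i ∈ as
  p⊆as i pi with i ∈? as
  ... | yes i∈as = i∈as
  ... | no  i∉as = contradiction (i , pi , i∉as) ¬witness

n≤∑+exceptions : ∀ {n} (d : Fin n → ℕ) (as : List (Fin n)) → (∀ i → 1 ≤ d i ⊎ i ∈ as) → n ≤ ∑ d + length as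
n≤∑+exceptions {n} d as covered = begin
  n                                        ≡⟨ sym (count-complement positive) ⟩
  count positive + count (not ∘ positive)  ≤⟨ +-mono-≤ count-positive≤∑
                                                         (count-≤-length (not ∘ positive) as nonpositive⊆as) ⟩
  ∑ d + length as                          ∎
  where
  open ≤-Reasoning
  positive : Fin _ → Bool
  positive i = 0 <ᵇ d i
  count-positive≤∑ : count positive ≤ ∑ d
  count-positive≤∑ = subst (_≤ ∑ d) (sym (count≡∑ positive)) (∑-mono-≤ 𝟙≤d)
    where
    𝟙≤d : ∀ i → 𝟙 (positive i) ≤ d i
    𝟙≤d i with d i
    ... | zero  = z≤n
    ... | suc _ = s≤s z≤n
  nonpositive⊆as : ∀ i → not (positive i) ≡ true → i ∈ as
  nonpositive⊆as i nonpositive with d i | covered i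
  ... | _     | inj₂ i∈as = i∈as
  ... | suc _ | inj₁ _    = contradiction nonpositive λ ()

n<∑+exceptions : ∀ {n} (d : Fin n → ℕ) (as : List (Fin n)) → (∀ i → 1 ≤ d i ⊎ i ∈ as) →
  ∀ e → 2 ≤ d e → n < ∑ d + length as
n<∑+exceptions {n} d as covered e 2≤de = begin-strict
  n                                         ≤⟨ n≤∑+exceptions (zeroAt e d) (e ∷ as) covered-without-e ⟩
  ∑ (zeroAt e d) + suc (length as)          ≡⟨ +-suc (∑ (zeroAt e d)) (length as) ⟩
  suc (∑ (zeroAt e d) + length as)          <⟨ +-monoˡ-≤ (∑ (zeroAt e d) + length as) 2≤de ⟩
  d e + (∑ (zeroAt e d) + length as)        ≡⟨ sym (+-assoc (d e) _ (length as)) ⟩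
  d e + ∑ (zeroAt e d) + length as          ≡⟨ cong (_+ length as) (sym (∑-zeroAt d e)) ⟩
  ∑ d + length as                           ∎
  where
  open ≤-Reasoning
  covered-without-e : ∀ i → 1 ≤ zeroAt e d i ⊎ i ∈ e ∷ as
  covered-without-e i with i ≟ᶠ e | covered i
  ... | yes i≡e | _         = inj₂ (here i≡e)
  ... | no  _   | inj₂ i∈as = inj₂ (there i∈as)
  ... | no  i≢e | inj₁ 1≤di = inj₁ (subst (1 ≤_) (sym (updateAt-minimal i e d i≢e)) 1≤di)

<ᵇ-asym : ∀ a b → (a <ᵇ b) ≡ true → (b <ᵇ a) ≡ true → ⊥
<ᵇ-asym a b a<b b<a = <-asym (<ᵇ⇒< a b (subst T (sym a<b) _)) (<ᵇ⇒< b a (subst T (sym b<a) _))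

<ᵇ-false⇒≡ : ∀ a b → (a <ᵇ b) ≡ false → (b <ᵇ a) ≡ false → a ≡ b
<ᵇ-false⇒≡ a b a≮b b≮a =
  ≤-antisym (≮⇒≥ (λ b<a → subst T b≮a (<⇒<ᵇ b<a))) (≮⇒≥ (λ a<b → subst T a≮b (<⇒<ᵇ a<b)))

<ᵇ-true : ∀ {a b} → a < b → (a <ᵇ b) ≡ true
<ᵇ-true {a} {b} a<b = ¬-not λ a≮b → subst T a≮b (<⇒<ᵇ a<b)

m≤o+k⇒m∸k≤o : ∀ {m o} k → m ≤ o + k → m ∸ k ≤ o
m≤o+k⇒m∸k≤o {m} {o} k m≤o+k = m≤n+o⇒m∸n≤o m k (subst (m ≤_) (+-comm o k) m≤o+k)

module _ {n} (m : Fin n → Fin n → Bool) (m-sym : ∀ i j → m i j ≡ m j i) (m-irrefl : ∀ i → m i i ≡ false) where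

  private
    ∑₂ : (Fin n → Fin n → ℕ) → ℕ
    ∑₂ h = ∑ (λ i → ∑ (h i))

    ∑₂-distrib-+ : ∀ f g → ∑₂ (λ i j → f i j + g i j) ≡ ∑₂ f + ∑₂ g
    ∑₂-distrib-+ f g = trans (sum-cong-≗ (λ i → ∑-distrib-+ (f i) (g i))) (∑-distrib-+ (λ i → ∑ (f i)) (λ i → ∑ (g i)))

    ∑₂-mono-≤ : ∀ {f g} → (∀ i j → f i j ≤ g i j) → ∑₂ f ≤ ∑₂ g
    ∑₂-mono-≤ f≤g = ∑-mono-≤ (λ i → ∑-mono-≤ (f≤g i))

  -- Each m-edge is counted at most once on the left, at its endpoint of larger ρ.
  ∑-count-below≤∑-count-after : ∀ (ρ : Fin n → ℕ) →
    ∑ (λ i → count (λ j → (ρ j <ᵇ ρ i) ∧ m i j)) ≤ ∑ (λ i → count (λ j → (toℕ i <ᵇ toℕ j) ∧ m i j))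
  ∑-count-below≤∑-count-after ρ = begin
    ∑ (λ i → count (below i))                                          ≡⟨ sum-cong-≗ (λ i → count≡∑ (below i)) ⟩
    ∑₂ (λ i j → 𝟙 (below i j))                                         ≤⟨ ∑₂-mono-≤ split-by-index ⟩
    ∑₂ (λ i j → 𝟙 (after i j ∧ below i j) + 𝟙 (after j i ∧ below i j)) ≡⟨ ∑₂-distrib-+ _ _ ⟩
    ∑₂ (λ i j → 𝟙 (after i j ∧ below i j)) + ∑₂ (λ i j → 𝟙 (after j i ∧ below i j))
        ≡⟨ cong (∑₂ (λ i j → 𝟙 (after i j ∧ below i j)) +_) (∑-comm (λ i j → 𝟙 (after j i ∧ below i j))) ⟩
    ∑₂ (λ i j → 𝟙 (after i j ∧ below i j)) + ∑₂ (λ i j → 𝟙 (after i j ∧ below j i))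
        ≡⟨ sym (∑₂-distrib-+ _ _) ⟩
    ∑₂ (λ i j → 𝟙 (after i j ∧ below i j) + 𝟙 (after i j ∧ below j i)) ≤⟨ ∑₂-mono-≤ below-exclusive ⟩
    ∑₂ (λ i j → 𝟙 (after i j ∧ m i j))
        ≡⟨ sym (sum-cong-≗ (λ i → count≡∑ (λ j → after i j ∧ m i j))) ⟩
    ∑ (λ i → count (λ j → after i j ∧ m i j))                          ∎
    where
    open ≤-Reasoning
    below after : Fin n → Fin n → Bool
    below i j = (ρ j <ᵇ ρ i) ∧ m i j
    after i j = toℕ i <ᵇ toℕ j

    split-by-index : ∀ i j → 𝟙 (below i j) ≤ 𝟙 (after i j ∧ below i j) + 𝟙 (after j i ∧ below i j)
    split-by-index i j with after i j in i<j | after j i in j<i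
    ... | true  | _     = m≤m+n _ _
    ... | false | true  = ≤-refl
    ... | false | false with toℕ-injective (<ᵇ-false⇒≡ (toℕ i) (toℕ j) i<j j<i)
    ... | refl rewrite m-irrefl i | ∧-zeroʳ (ρ i <ᵇ ρ i) = z≤n

    below-exclusive : ∀ i j → 𝟙 (after i j ∧ below i j) + 𝟙 (after i j ∧ below j i) ≤ 𝟙 (after i j ∧ m i j)
    below-exclusive i j rewrite m-sym j i with after i j | m i j
    ... | false | _    = z≤n
    ... | true  | false rewrite ∧-zeroʳ (ρ j <ᵇ ρ i) | ∧-zeroʳ (ρ i <ᵇ ρ j) = z≤n
    ... | true  | true with ρ j <ᵇ ρ i in j<i | ρ i <ᵇ ρ j in i<j
    ... | true  | true  = ⊥-elim (<ᵇ-asym (ρ j) (ρ i) j<i i<j)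
    ... | true  | false = ≤-refl
    ... | false | true  = ≤-refl
    ... | false | false = z≤n

module _ {n} {G : Graph n} (B : EdgeSet G) where

  mem-irrefl : ∀ i → mem B i i ≡ false
  mem-irrefl i = ¬-not λ ii∈B → contradiction (trans (sym (sub B i i ii∈B)) (irrefl G i)) λ ()

  bondsBelow : (Fin n → ℕ) → Fin n → ℕ
  bondsBelow ρ i = count (λ j → (ρ j <ᵇ ρ i) ∧ mem B i j)

  ∑-bondsBelow≤card : ∀ ρ → ∑ (bondsBelow ρ) ≤ card B
  ∑-bondsBelow≤card ρ =
    subst (∑ (bondsBelow ρ) ≤_) (sym (sum-map-allFin (λ i → count (λ j → (toℕ i <ᵇ toℕ j) ∧ mem B i j))))
          (∑-count-below≤∑-count-after (mem B) (msym B) mem-irrefl ρ)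

  bondsBelow-≥1 : ∀ ρ {i j} → ρ j < ρ i → mem B i j ≡ true → 1 ≤ bondsBelow ρ i
  bondsBelow-≥1 ρ {i} {j} j<i ij∈B =
    length-≤-count _ {j ∷ []} (All.[] ∷ []) λ { _ (here refl) → cong₂ _∧_ (<ᵇ-true j<i) ij∈B }

  bondsBelow-≥2 : ∀ ρ {i j j′} → j ≢ j′ → ρ j < ρ i → ρ j′ < ρ i → mem B i j ≡ true → mem B i j′ ≡ true →
    2 ≤ bondsBelow ρ i
  bondsBelow-≥2 ρ j≢j′ j<i j′<i ij∈B ij′∈B =
    length-≤-count _ ((j≢j′ All.∷ All.[]) ∷ All.[] ∷ []) λ
      { _ (here refl)         → cong₂ _∧_ (<ᵇ-true j<i) ij∈B
      ; _ (there (here refl)) → cong₂ _∧_ (<ᵇ-true j′<i) ij′∈B }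

  card-bound : ∀ ρ {a b} → (∀ i → 1 ≤ bondsBelow ρ i ⊎ i ∈ a ∷ b ∷ []) → n ∸ 2 ≤ card B
  card-bound ρ covered = ≤-trans (m≤o+k⇒m∸k≤o 2 (n≤∑+exceptions (bondsBelow ρ) _ covered)) (∑-bondsBelow≤card ρ)

  card-bound-surplus : ∀ ρ {a b c} → (∀ i → 1 ≤ bondsBelow ρ i ⊎ i ∈ a ∷ b ∷ c ∷ []) →
    ∀ e → 2 ≤ bondsBelow ρ e → n ∸ 2 ≤ card B
  card-bound-surplus ρ covered e surplus =
    ≤-trans (m≤o+k⇒m∸k≤o 3 (n<∑+exceptions (bondsBelow ρ) _ covered e surplus)) (∑-bondsBelow≤card ρ)

module _ {n : ℕ} where

  constOn : List (Fin n) → ℕ → Fin n → ℕ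
  constOn S c i = if does (i ∈? S) then c else 0

  ∑-constOn : ∀ S c → ∑ (constOn S c) ≤ length S * c
  ∑-constOn S c = ∑-≤-length* S ≤c outside
    where
    ≤c : ∀ i → constOn S c i ≤ c
    ≤c i with i ∈? S
    ... | yes _ = ≤-refl
    ... | no  _ = z≤n
    outside : ∀ i → i ∉ S → constOn S c i ≡ 0
    outside i i∉S rewrite dec-false (i ∈? S) i∉S = refl

  roman : List (Fin n) → List (Fin n) → Fin n → ℕ
  roman twos ones i = if does (i ∈? twos) then 2 else constOn ones 1 i

  weight-roman : ∀ twos ones → weight (roman twos ones) ≤ length twos * 2 + length ones * 1
  weight-roman twos ones = begin
    weight (roman twos ones)                       ≡⟨ sum-map-allFin (roman twos ones) ⟩
    ∑ (roman twos ones)                            ≤⟨ ∑-mono-≤ split ⟩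
    ∑ (λ i → constOn twos 2 i + constOn ones 1 i)  ≡⟨ ∑-distrib-+ (constOn twos 2) (constOn ones 1) ⟩
    ∑ (constOn twos 2) + ∑ (constOn ones 1)        ≤⟨ +-mono-≤ (∑-constOn twos 2) (∑-constOn ones 1) ⟩
    length twos * 2 + length ones * 1              ∎
    where
    open ≤-Reasoning
    split : ∀ i → roman twos ones i ≤ constOn twos 2 i + constOn ones 1 i
    split i with i ∈? twos
    ... | yes _ = m≤m+n 2 _
    ... | no  _ = ≤-refl

  roman-isRDF : ∀ (H : Graph n) twos ones →
    (∀ c → c ∉ twos → c ∉ ones → ∃ λ s → s ∈ twos × adj H c s ≡ true) → IsRDF H (roman twos ones)
  roman-isRDF H twos ones dominated = ≤2 , zero-dominated
    where
    ≤2 : ∀ i → roman twos ones i ≤ 2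
    ≤2 i with i ∈? twos | i ∈? ones
    ... | yes _ | _     = ≤-refl
    ... | no  _ | yes _ = s≤s z≤n
    ... | no  _ | no  _ = z≤n
    zero-dominated : ∀ c → roman twos ones c ≡ 0 → Σ (Fin n) λ s → adj H c s ≡ true × roman twos ones s ≡ 2
    zero-dominated c r≡0 with c ∈? twos | c ∈? ones
    zero-dominated c () | yes _ | _
    zero-dominated c () | no  _ | yes _
    ... | no c∉twos | no c∉ones with dominated c c∉twos c∉ones
    ... | s , s∈twos , cs = s , cs , cong (λ b → if b then 2 else constOn ones 1 s) (dec-true (s ∈? twos) s∈twos)

adjacent⇒≢ : ∀ {n} (G : Graph n) {u v} → adj G u v ≡ true → u ≢ v
adjacent⇒≢ G {u} uv refl = contradiction (trans (sym uv) (irrefl G u)) λ ()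

neighbour≢non-neighbour : ∀ {n} (G : Graph n) {u a b} → adj G u a ≡ true → adj G u b ≡ false → a ≢ b
neighbour≢non-neighbour G ua ¬ub refl = contradiction (trans (sym ua) ¬ub) λ ()

adj-sym : ∀ {n} (G : Graph n) {u v b} → adj G u v ≡ b → adj G v u ≡ b
adj-sym G {u} {v} uv = trans (Graph.sym G v u) uv

record NonNeighbours {n} (G : Graph n) (v a b : Fin n) : Set where
  field
    a≢v : a ≢ v
    b≢v : b ≢ v
    a≢b : a ≢ b
    ¬va : adj G v a ≡ false
    ¬vb : adj G v b ≡ false

NonNeighbours-swap : ∀ {n} {G : Graph n} {v a b} → NonNeighbours G v a b → NonNeighbours G v b a
NonNeighbours-swap N = record { a≢v = b≢v ; b≢v = a≢v ; a≢b = ≢-sym a≢b ; ¬va = ¬vb ; ¬vb = ¬va }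
  where open NonNeighbours N

NonNeighbours-rotate : ∀ {n} {G : Graph n} {v a b} → NonNeighbours G v a b → adj G b a ≡ false → NonNeighbours G b v a
NonNeighbours-rotate {G = G} N ¬ba = record
  { a≢v = ≢-sym b≢v ; b≢v = a≢b ; a≢b = ≢-sym a≢v ; ¬va = adj-sym G ¬vb ; ¬vb = ¬ba }
  where open NonNeighbours N

module Regular-n∸3 {n} (G : Graph n) (regular : Regular G (n ∸ 3)) (3≤n : 3 ≤ n) where

  -- v itself is among its three non-adjacent vertices.
  count-non-adjacent : ∀ v → count (not ∘ adj G v) ≡ 3
  count-non-adjacent v = +-cancelˡ-≡ (n ∸ 3) _ _ (begin
    n ∸ 3 + count (not ∘ adj G v)          ≡⟨ cong (_+ count (not ∘ adj G v)) (sym (regular v)) ⟩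
    count (adj G v) + count (not ∘ adj G v) ≡⟨ count-complement (adj G v) ⟩
    n                                       ≡⟨ sym (m∸n+n≡m 3≤n) ⟩
    n ∸ 3 + 3                               ∎)
    where open ≡-Reasoning

  non-neighbour-cases : ∀ {v a b} → NonNeighbours G v a b → ∀ c → adj G v c ≡ false → c ≡ v ⊎ c ≡ a ⊎ c ≡ b
  non-neighbour-cases {v} {a} {b} N c ¬vc with c ≟ᶠ v | c ≟ᶠ a | c ≟ᶠ b
  ... | yes c≡v | _       | _       = inj₁ c≡v
  ... | no  _   | yes c≡a | _       = inj₂ (inj₁ c≡a)
  ... | no  _   | no  _   | yes c≡b = inj₂ (inj₂ c≡b)
  ... | no  c≢v | no  c≢a | no  c≢b = contradiction four≤count (subst (λ k → ¬ 4 ≤ k) (sym (count-non-adjacent v)) (<-irrefl refl))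
    where
    open NonNeighbours N
    four≤count : 4 ≤ count (not ∘ adj G v)
    four≤count = length-≤-count (not ∘ adj G v) {v ∷ a ∷ b ∷ c ∷ []}
      ((≢-sym a≢v All.∷ ≢-sym b≢v All.∷ ≢-sym c≢v All.∷ All.[]) ∷
       (a≢b All.∷ ≢-sym c≢a All.∷ All.[]) ∷ (≢-sym c≢b All.∷ All.[]) ∷ All.[] ∷ [])
      λ { _ (here refl) → cong not (irrefl G v)
        ; _ (there (here refl)) → cong not ¬va
        ; _ (there (there (here refl))) → cong not ¬vb
        ; _ (there (there (there (here refl)))) → cong not ¬vc }

  adjacent-unless : ∀ {v a b} → NonNeighbours G v a b → ∀ {c} → c ≢ v → c ≢ a → c ≢ b → adj G v c ≡ true
  adjacent-unless N {c} c≢v c≢a c≢b = ¬-not λ ¬vc → case non-neighbour-cases N c ¬vc of λ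
    { (inj₁ c≡v) → c≢v c≡v ; (inj₂ (inj₁ c≡a)) → c≢a c≡a ; (inj₂ (inj₂ c≡b)) → c≢b c≡b }

  -- Opaque: unfolding the search in count-witness makes with-abstraction over these witnesses very slow.
  opaque
    other-non-neighbour : ∀ {v a} → a ≢ v → adj G v a ≡ false → ∃ λ b → NonNeighbours G v a b
    other-non-neighbour {v} {a} a≢v ¬va with count-witness (not ∘ adj G v) (v ∷ a ∷ [])
                                               (subst (2 <_) (sym (count-non-adjacent v)) ≤-refl)
    ... | b , ¬vb , b∉va = b , record
      { a≢v = a≢v ; b≢v = b∉va ∘ here ; a≢b = λ a≡b → b∉va (there (here (sym a≡b)))
      ; ¬va = ¬va ; ¬vb = not-injective ¬vb }

    non-neighbours : ∀ v → ∃ λ a → ∃ λ b → NonNeighbours G v a b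
    non-neighbours v with count-witness (not ∘ adj G v) (v ∷ []) (subst (1 <_) (sym (count-non-adjacent v)) (s≤s (s≤s z≤n)))
    ... | a , ¬va , a∉v = a , other-non-neighbour (a∉v ∘ here) (not-injective ¬va)

  γR≥4 : 4 ≤ n → ∀ f → IsRDF G f → 4 ≤ weight f
  γR≥4 4≤n f (_ , dominated) = subst (4 ≤_) (sym (sum-map-allFin f)) (four≤∑ (any? (λ v → f v ≟ 2)))
    where
    second-two : ∀ {v} → f v ≡ 2 → ∀ c → adj G v c ≡ false → f c ≡ 0 → 4 ≤ ∑ f
    second-two {v} fv≡2 c ¬vc fc≡0 with dominated c fc≡0
    ... | u , cu , fu≡2 = length*≤∑ ((v≢u All.∷ All.[]) ∷ All.[] ∷ [])
                            λ { _ (here refl) → ≤-reflexive (sym fv≡2) ; _ (there (here refl)) → ≤-reflexive (sym fu≡2) }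
      where
      v≢u : v ≢ u
      v≢u refl = contradiction (trans (sym cu) (adj-sym G ¬vc)) λ ()

    four≤∑ : Dec (∃ λ v → f v ≡ 2) → 4 ≤ ∑ f
    four≤∑ (no no-two) = ≤-trans 4≤n (subst (_≤ ∑ f) (trans (∑-const n 1) (*-identityʳ n)) (∑-mono-≤ positive))
      where
      positive : ∀ i → 1 ≤ f i
      positive i with f i in fi
      ... | suc _ = s≤s z≤n
      ... | zero  = contradiction (map₂ proj₂ (dominated i fi)) no-two
    four≤∑ (yes (v , fv≡2)) with non-neighbours v
    ... | a , b , N with f a in fa | f b in fb
    ...   | zero  | _     = second-two fv≡2 a (NonNeighbours.¬va N) fa
    ...   | suc _ | zero  = second-two fv≡2 b (NonNeighbours.¬vb N) fb
    ...   | suc _ | suc _ = begin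
      2 + 2 * 1               ≤⟨ +-mono-≤ (≤-reflexive (sym fv≡2))
                                          (length*≤∑ ((a≢b All.∷ All.[]) ∷ All.[] ∷ []) positive-ab) ⟩
      f v + ∑ (zeroAt v f)    ≡⟨ sym (∑-zeroAt f v) ⟩
      ∑ f                     ∎
      where
      open ≤-Reasoning
      open NonNeighbours N
      positive-ab : ∀ i → i ∈ a ∷ b ∷ [] → 1 ≤ zeroAt v f i
      positive-ab _ (here refl)         = subst (1 ≤_) (sym (trans (updateAt-minimal a v f a≢v) fa)) (s≤s z≤n)
      positive-ab _ (there (here refl)) = subst (1 ≤_) (sym (trans (updateAt-minimal b v f b≢v) fb)) (s≤s z≤n)

module RomanBondage {n} (G : Graph n) (regular : Regular G (n ∸ 3)) (7≤n : 7 ≤ n)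
                    (B : EdgeSet G) (bondage : IsRomanBondage G B) where

  open Regular-n∸3 G regular (≤-trans (s≤s (s≤s (s≤s z≤n))) 7≤n) public

  no-light-RDF : ∀ g → IsRDF (G ⊖ B) g → weight g ≤ 4 → ⊥
  no-light-RDF g g-RDF light = too-light bondage
    where
    too-light : IsRomanBondage G B → ⊥
    too-light (k , ((f , f-RDF , wf≡k) , _) , k<weight) =
      <-irrefl refl (≤-trans (s≤s 4≤k) (≤-trans (k<weight g g-RDF) light))
      where
      4≤k : 4 ≤ k
      4≤k = subst (4 ≤_) wf≡k (γR≥4 (≤-trans (s≤s (s≤s (s≤s (s≤s z≤n)))) 7≤n) f f-RDF)

  Unlinked : Fin n → Fin n → Set
  Unlinked u c = adj G u c ≡ false ⊎ mem B u c ≡ true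

  Unlinked-sym : ∀ {u c} → Unlinked u c → Unlinked c u
  Unlinked-sym {u} {c} (inj₁ ¬uc)  = inj₁ (adj-sym G ¬uc)
  Unlinked-sym {u} {c} (inj₂ uc∈B) = inj₂ (trans (msym B c u) uc∈B)

  unlinked : ∀ {u c} → adj (G ⊖ B) u c ≡ false → Unlinked u c
  unlinked {u} {c} ¬uc with adj G u c | mem B u c
  ... | false | _    = inj₁ refl
  ... | true  | true = inj₂ refl

  bond-if-adjacent : ∀ {u c} → Unlinked u c → adj G u c ≡ true → mem B u c ≡ true
  bond-if-adjacent (inj₁ ¬uc)  uc = contradiction (trans (sym uc) ¬uc) λ ()
  bond-if-adjacent (inj₂ uc∈B) _  = uc∈B

  -- Otherwise 2 on u and v would be a Roman dominating function of G − B of weight 4.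
  common-unlinked : ∀ {u v} → u ≢ v → ∃ λ c → c ≢ u × c ≢ v × Unlinked u c × Unlinked v c
  common-unlinked {u} {v} u≢v
    with any? (λ c → ¬? (c ∈? u ∷ v ∷ []) ×-dec adj (G ⊖ B) c u ≟ᵇ false ×-dec adj (G ⊖ B) c v ≟ᵇ false)
  ... | yes (c , c∉uv , ¬cu , ¬cv) =
    c , c∉uv ∘ here , c∉uv ∘ there ∘ here , Unlinked-sym (unlinked ¬cu) , Unlinked-sym (unlinked ¬cv)
  ... | no none = ⊥-elim (no-light-RDF (roman (u ∷ v ∷ []) []) (roman-isRDF (G ⊖ B) (u ∷ v ∷ []) [] dominated)
                                       (weight-roman (u ∷ v ∷ []) []))
    where
    dominated : ∀ c → c ∉ u ∷ v ∷ [] → c ∉ [] → ∃ λ s → s ∈ u ∷ v ∷ [] × adj (G ⊖ B) c s ≡ true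
    dominated c c∉uv _ with adj (G ⊖ B) c u in cu | adj (G ⊖ B) c v in cv
    ... | true  | _     = u , here refl , cu
    ... | false | true  = v , there (here refl) , cv
    ... | false | false = contradiction (c , c∉uv , cu , cv) none

  -- If u has a single bond u u′, the vertex missed by u and v in G − B is r.
  bond-to-second-non-neighbour : ∀ {u u′ v r} → (∀ {c} → mem B u c ≡ true → c ≡ u′) → NonNeighbours G u v r →
    (Unlinked v u′ → ⊥) → adj G v r ≡ true → mem B v r ≡ true
  bond-to-second-non-neighbour only-uu′ N ¬vu′ vr with common-unlinked (≢-sym (NonNeighbours.a≢v N))
  ... | c , _ , c≢v , inj₂ uc∈B , vc = ⊥-elim (¬vu′ (subst (Unlinked _) (only-uu′ uc∈B) vc))
  ... | c , c≢u , c≢v , inj₁ ¬uc , vc with non-neighbour-cases N c ¬uc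
  ...   | inj₁ c≡u        = ⊥-elim (c≢u c≡u)
  ...   | inj₂ (inj₁ c≡v) = ⊥-elim (c≢v c≡v)
  ...   | inj₂ (inj₂ refl) = bond-if-adjacent vc vr

  -- Otherwise 2 on v and 1 on its two non-neighbours would be one.
  has-bond : ∀ v → ∃ λ c → mem B v c ≡ true
  has-bond v with any? (λ c → mem B v c ≟ᵇ true) | non-neighbours v
  ... | yes bond     | _         = bond
  ... | no  no-bond  | a , b , N =
    ⊥-elim (no-light-RDF (roman (v ∷ []) (a ∷ b ∷ [])) (roman-isRDF (G ⊖ B) (v ∷ []) (a ∷ b ∷ []) dominated)
                      (weight-roman (v ∷ []) (a ∷ b ∷ [])))
    where
    dominated : ∀ c → c ∉ v ∷ [] → c ∉ a ∷ b ∷ [] → ∃ λ s → s ∈ v ∷ [] × adj (G ⊖ B) c s ≡ true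
    dominated c c∉v c∉ab =
      v , here refl , cong₂ (λ e m → e ∧ not m) cv (¬-not λ cv∈B → no-bond (c , trans (msym B v c) cv∈B))
      where
      cv : adj G c v ≡ true
      cv = adj-sym G (adjacent-unless N (c∉v ∘ here) (c∉ab ∘ here) (c∉ab ∘ there ∘ here))

module Setting {n} (G : Graph n) (regular : Regular G (n ∸ 3)) (7≤n : 7 ≤ n) (B : EdgeSet G) (bondage : IsRomanBondage G B)
               {x w y z q : Fin n} (xw : adj G x w ≡ true) (Nx : NonNeighbours G x y z) (Nw : NonNeighbours G w y q)
               (xw∈B : mem B x w ≡ true) (only-xw : ∀ v → mem B x v ≡ true → v ≡ w) where

  open RomanBondage G regular 7≤n B bondage public
  open NonNeighbours Nx using () renaming (a≢v to y≢x; b≢v to z≢x; a≢b to y≢z; ¬va to ¬xy; ¬vb to ¬xz)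
  open NonNeighbours Nw using () renaming (a≢v to y≢w; b≢v to q≢w; a≢b to y≢q; ¬va to ¬wy; ¬vb to ¬wq)

  x≢w : x ≢ w
  x≢w = adjacent⇒≢ G xw

  z≢w : z ≢ w
  z≢w = ≢-sym (neighbour≢non-neighbour G xw ¬xz)

  Ny : NonNeighbours G y x w
  Ny = record { a≢v = ≢-sym y≢x ; b≢v = ≢-sym y≢w ; a≢b = x≢w ; ¬va = adj-sym G ¬xy ; ¬vb = adj-sym G ¬wy }

  Anchor : Fin n → Set
  Anchor a = a ≡ y ⊎ a ≡ z ⊎ a ≡ w

  y-Anchor : Anchor y
  y-Anchor = inj₁ refl

  z-Anchor : Anchor z
  z-Anchor = inj₂ (inj₁ refl)

  w-Anchor : Anchor w
  w-Anchor = inj₂ (inj₂ refl)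

  record Other (u : Fin n) : Set where
    constructor other
    field
      ≢x : u ≢ x
      ≢y : u ≢ y
      ≢z : u ≢ z
      ≢w : u ≢ w

  classify : ∀ i → i ≡ x ⊎ Anchor i ⊎ Other i
  classify i with i ≟ᶠ x | i ≟ᶠ y | i ≟ᶠ z | i ≟ᶠ w
  ... | yes i≡x | _       | _       | _       = inj₁ i≡x
  ... | no  _   | yes i≡y | _       | _       = inj₂ (inj₁ (inj₁ i≡y))
  ... | no  _   | no  _   | yes i≡z | _       = inj₂ (inj₁ (inj₂ (inj₁ i≡z)))
  ... | no  _   | no  _   | no  _   | yes i≡w = inj₂ (inj₁ (inj₂ (inj₂ i≡w)))
  ... | no  i≢x | no  i≢y | no  i≢z | no  i≢w = inj₂ (inj₂ (other i≢x i≢y i≢z i≢w))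

  Anchor≢Other : ∀ {a u} → Anchor a → Other u → a ≢ u
  Anchor≢Other (inj₁ refl)        (other _ u≢y _ _) = ≢-sym u≢y
  Anchor≢Other (inj₂ (inj₁ refl)) (other _ _ u≢z _) = ≢-sym u≢z
  Anchor≢Other (inj₂ (inj₂ refl)) (other _ _ _ u≢w) = ≢-sym u≢w

  x-adj : ∀ {u} → Other u → adj G x u ≡ true
  x-adj (other u≢x u≢y u≢z _) = adjacent-unless Nx u≢x u≢y u≢z

  y-adj : ∀ {u} → Other u → adj G y u ≡ true
  y-adj (other u≢x u≢y _ u≢w) = adjacent-unless Ny u≢y u≢x u≢w

  w-adj : ∀ {u} → Other u → u ≢ q → adj G w u ≡ true
  w-adj (other _ u≢y _ u≢w) u≢q = adjacent-unless Nw u≢w u≢y u≢q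

  non-neighbour-Other : ∀ {u c} → Other u → adj G z u ≡ true → u ≢ q → adj G u c ≡ false → Other c
  non-neighbour-Other {u} {c} uO zu u≢q ¬uc =
    other (λ { refl → linked (x-adj uO) }) (λ { refl → linked (y-adj uO) })
          (λ { refl → linked zu })        (λ { refl → linked (w-adj uO u≢q) })
    where
    linked : adj G c u ≡ true → ⊥
    linked cu = neighbour≢non-neighbour G cu (adj-sym G ¬uc) refl

  bond-sym : ∀ {u c} → mem B u c ≡ true → mem B c u ≡ true
  bond-sym {u} {c} uc∈B = trans (msym B c u) uc∈B

  bond⇒≢ : ∀ {u c} → mem B u c ≡ true → u ≢ c
  bond⇒≢ uc∈B = adjacent⇒≢ G (sub B _ _ uc∈B)

  unlinked-from-x : ∀ {c} → c ≢ x → Unlinked x c → Anchor c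
  unlinked-from-x {c} c≢x (inj₁ ¬xc) with non-neighbour-cases Nx c ¬xc
  ... | inj₁ c≡x        = ⊥-elim (c≢x c≡x)
  ... | inj₂ (inj₁ c≡y) = inj₁ c≡y
  ... | inj₂ (inj₂ c≡z) = inj₂ (inj₁ c≡z)
  unlinked-from-x c≢x (inj₂ xc∈B) = inj₂ (inj₂ (only-xw _ xc∈B))

  anchor-bond : ∀ {u} → Other u → adj G z u ≡ true → u ≢ q → ∃ λ a → Anchor a × mem B u a ≡ true
  anchor-bond {u} uO zu u≢q with common-unlinked (≢-sym (Other.≢x uO))
  ... | c , c≢x , _ , xc , uc with unlinked-from-x c≢x xc
  ... | inj₁ refl        = c , inj₁ refl        , bond-if-adjacent uc (adj-sym G (y-adj uO))
  ... | inj₂ (inj₁ refl) = c , inj₂ (inj₁ refl) , bond-if-adjacent uc (adj-sym G zu)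
  ... | inj₂ (inj₂ refl) = c , inj₂ (inj₂ refl) , bond-if-adjacent uc (adj-sym G (w-adj uO u≢q))

  bond-classify : ∀ {u c} → u ≢ w → mem B u c ≡ true → Anchor c ⊎ Other c
  bond-classify {u} {c} u≢w uc∈B with classify c
  ... | inj₁ refl = ⊥-elim (u≢w (only-xw u (bond-sym uc∈B)))
  ... | inj₂ c∈AO = c∈AO

  record Ranking : Set where
    field
      ρ       : Fin n → ℕ
      ρy      : ρ y ≡ 0
      ρw      : ρ w ≡ 0
      ρx      : ρ x ≡ 1
      ρz      : ρ z ≡ 1
      ρ-Other : ∀ {u} → Other u → 2 ≤ ρ u
      ρ-injective-Other : ∀ {u c} → Other u → Other c → ρ u ≡ ρ c → u ≡ c

  module Ranked (R : Ranking) where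
    open Ranking R public

    Surplus : Set
    Surplus = ∃ λ e → 2 ≤ bondsBelow B ρ e

    anchor≤1 : ∀ {a} → Anchor a → ρ a ≤ 1
    anchor≤1 (inj₁ refl)        = subst (_≤ 1) (sym ρy) z≤n
    anchor≤1 (inj₂ (inj₁ refl)) = ≤-reflexive ρz
    anchor≤1 (inj₂ (inj₂ refl)) = subst (_≤ 1) (sym ρw) z≤n

    anchor<Other : ∀ {a u} → Anchor a → Other u → ρ a < ρ u
    anchor<Other aA uO = ≤-trans (s≤s (anchor≤1 aA)) (ρ-Other uO)

    two-anchor-bonds : ∀ {u a b} → Other u → Anchor a → Anchor b → a ≢ b →
      mem B u a ≡ true → mem B u b ≡ true → Surplus
    two-anchor-bonds uO aA bA a≢b ua ub = _ , bondsBelow-≥2 B ρ a≢b (anchor<Other aA uO) (anchor<Other bA uO) ua ub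

    AnchorBond : Fin n → Set
    AnchorBond u = ∃ λ a → Anchor a × mem B u a ≡ true

    -- The higher-ranked of the two has both its anchor bond and the bond u c below it.
    bonded-Others : ∀ {u c} → Other u → Other c → mem B u c ≡ true → AnchorBond u → AnchorBond c → Surplus
    bonded-Others {u} {c} uO cO uc∈B (a , aA , ua) (b , bA , cb) with <-cmp (ρ u) (ρ c)
    ... | tri< u<c _ _ = c , bondsBelow-≥2 B ρ (Anchor≢Other bA uO) (anchor<Other bA cO) u<c cb (bond-sym uc∈B)
    ... | tri≈ _ u≡c _ = ⊥-elim (bond⇒≢ uc∈B (ρ-injective-Other uO cO u≡c))
    ... | tri> _ _ c<u = u , bondsBelow-≥2 B ρ (Anchor≢Other aA cO) (anchor<Other aA uO) c<u ua uc∈B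

    ρy<ρz : ρ y < ρ z
    ρy<ρz = subst₂ _<_ (sym ρy) (sym ρz) ≤-refl

    ρw<ρz : ρ w < ρ z
    ρw<ρz = subst₂ _<_ (sym ρw) (sym ρz) ≤-refl

    x-covered : 1 ≤ bondsBelow B ρ x
    x-covered = bondsBelow-≥1 B ρ (subst₂ _<_ (sym ρw) (sym ρx) ≤-refl) xw∈B

    Other-covered : ∀ {u} → Other u → AnchorBond u → 1 ≤ bondsBelow B ρ u
    Other-covered uO (a , aA , ua) = bondsBelow-≥1 B ρ (anchor<Other aA uO) ua

    AnchoredBonds : Fin n → Fin n → Set
    AnchoredBonds u a₀ = ∀ c → mem B u c ≡ true → c ≡ a₀ ⊎ Surplus

    anchored-bonds : ∀ {u a₀} → Other u → Anchor a₀ → mem B u a₀ ≡ true →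
      (∀ {c} → Other c → mem B u c ≡ true → AnchorBond c) → AnchoredBonds u a₀
    anchored-bonds {u} {a₀} uO a₀A ua₀ bonded-anchored c uc∈B with bond-classify (Other.≢w uO) uc∈B
    ... | inj₂ cO = inj₂ (bonded-Others uO cO uc∈B (a₀ , a₀A , ua₀) (bonded-anchored cO uc∈B))
    ... | inj₁ cA with c ≟ᶠ a₀
    ...   | yes c≡a₀ = inj₁ c≡a₀
    ...   | no  c≢a₀ = inj₂ (two-anchor-bonds uO a₀A cA (≢-sym c≢a₀) ua₀ uc∈B)

    unlinked-cases : ∀ {u a b a₀ c} → NonNeighbours G u a b → AnchoredBonds u a₀ → c ≢ u → Unlinked u c →
      c ≡ a ⊎ c ≡ b ⊎ c ≡ a₀ ⊎ Surplus
    unlinked-cases N _ c≢u (inj₁ ¬uc) with non-neighbour-cases N _ ¬uc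
    ... | inj₁ c≡u        = ⊥-elim (c≢u c≡u)
    ... | inj₂ (inj₁ c≡a) = inj₁ c≡a
    ... | inj₂ (inj₂ c≡b) = inj₂ (inj₁ c≡b)
    unlinked-cases N bonds _ (inj₂ uc∈B) with bonds _ uc∈B
    ... | inj₁ c≡a₀   = inj₂ (inj₂ (inj₁ c≡a₀))
    ... | inj₂ surplus = inj₂ (inj₂ (inj₂ surplus))

    unlinked-anchor-bond : ∀ {a u a₀ b b′} → NonNeighbours G u b b′ → AnchoredBonds u a₀ → a ≢ u →
      (Unlinked a b → ⊥) → (Unlinked a a₀ → ⊥) → (adj G a b′ ≡ false → b′ ≢ a → ⊥) →
      (mem B a b′ ≡ true × b′ ≢ a) ⊎ Surplus
    unlinked-anchor-bond N bonds a≢u ¬ab ¬aa₀ ab′ with common-unlinked a≢u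
    ... | c , c≢a , c≢u , ac , uc with unlinked-cases N bonds c≢u uc
    ...   | inj₁ refl               = ⊥-elim (¬ab ac)
    ...   | inj₂ (inj₂ (inj₁ refl)) = ⊥-elim (¬aa₀ ac)
    ...   | inj₂ (inj₂ (inj₂ s))    = inj₂ s
    ...   | inj₂ (inj₁ refl) with ac
    ...     | inj₁ ¬ac  = ⊥-elim (ab′ ¬ac c≢a)
    ...     | inj₂ ac∈B = inj₁ (ac∈B , c≢a)

  baseRank : Fin n → ℕ
  baseRank i = if does (i ∈? y ∷ w ∷ []) then 0 else if does (i ∈? x ∷ z ∷ []) then 1 else 2 + toℕ i

  rank-low : ∀ {i} → i ∈ y ∷ w ∷ [] → baseRank i ≡ 0
  rank-low {i} i∈yw = cong (λ b → if b then 0 else _) (dec-true (i ∈? y ∷ w ∷ []) i∈yw)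

  rank-middle : ∀ {i} → i ∉ y ∷ w ∷ [] → i ∈ x ∷ z ∷ [] → baseRank i ≡ 1
  rank-middle {i} i∉yw i∈xz rewrite dec-false (i ∈? y ∷ w ∷ []) i∉yw | dec-true (i ∈? x ∷ z ∷ []) i∈xz = refl

  baseRank-Other : ∀ {u} → Other u → baseRank u ≡ 2 + toℕ u
  baseRank-Other {u} (other u≢x u≢y u≢z u≢w)
    rewrite dec-false (u ∈? y ∷ w ∷ []) (λ { (here u≡y) → u≢y u≡y ; (there (here u≡w)) → u≢w u≡w })
          | dec-false (u ∈? x ∷ z ∷ []) (λ { (here u≡x) → u≢x u≡x ; (there (here u≡z)) → u≢z u≡z }) = refl

  baseRank≤n+1 : ∀ i → baseRank i ≤ n + 1
  baseRank≤n+1 i with does (i ∈? y ∷ w ∷ []) | does (i ∈? x ∷ z ∷ [])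
  ... | true  | _     = z≤n
  ... | false | true  = subst (1 ≤_) (+-comm 1 n) (m≤m+n 1 n)
  ... | false | false = subst (2 + toℕ i ≤_) (+-comm 1 n) (s≤s (toℕ<n i))
  baseRanking : Ranking
  baseRanking = record
    { ρ = baseRank
    ; ρy = rank-low (here refl)
    ; ρw = rank-low (there (here refl))
    ; ρx = rank-middle (λ { (here x≡y) → y≢x (sym x≡y) ; (there (here x≡w)) → x≢w x≡w }) (here refl)
    ; ρz = rank-middle (λ { (here z≡y) → y≢z (sym z≡y) ; (there (here z≡w)) → z≢w z≡w }) (there (here refl))
    ; ρ-Other = λ uO → subst (2 ≤_) (sym (baseRank-Other uO)) (m≤m+n 2 _)
    ; ρ-injective-Other = λ uO cO eq → toℕ-injective (+-cancelˡ-≡ 2 _ _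
                            (trans (sym (baseRank-Other uO)) (trans eq (baseRank-Other cO))))
    }

  z-adj-y : adj G z y ≡ true
  z-adj-y = adj-sym G (adjacent-unless Ny (≢-sym y≢z) z≢x z≢w)

  module Case-q≡z (q≡z : q ≡ z) where
    open Ranked baseRanking

    Other≢q : ∀ {u} → Other u → u ≢ q
    Other≢q (other _ _ u≢z _) u≡q = u≢z (trans u≡q q≡z)

    Nz : NonNeighbours G z x w
    Nz = record { a≢v = ≢-sym z≢x ; b≢v = ≢-sym z≢w ; a≢b = x≢w ; ¬va = adj-sym G ¬xz
                ; ¬vb = adj-sym G (subst (λ v → adj G w v ≡ false) q≡z ¬wq) }

    anchor-adj : ∀ {a u} → Anchor a → Other u → adj G u a ≡ true
    anchor-adj {a} {u} aA uO = adj-sym G (adj-a aA)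
      where
      adj-a : Anchor a → adj G a u ≡ true
      adj-a (inj₁ refl)        = y-adj uO
      adj-a (inj₂ (inj₁ refl)) = adjacent-unless Nz (Other.≢z uO) (Other.≢x uO) (Other.≢w uO)
      adj-a (inj₂ (inj₂ refl)) = w-adj uO (Other≢q uO)

    z-adj : ∀ {u} → Other u → adj G z u ≡ true
    z-adj {u} uO = adj-sym G (anchor-adj z-Anchor uO)

    Other-anchored : ∀ {u} → Other u → AnchorBond u
    Other-anchored uO = anchor-bond uO (z-adj uO) (Other≢q uO)

    non-neighbour-Other′ : ∀ {u c} → Other u → adj G u c ≡ false → Other c
    non-neighbour-Other′ uO = non-neighbour-Other uO (z-adj uO) (Other≢q uO)

    bonds-of-Other : ∀ {u a₀} → Other u → Anchor a₀ → mem B u a₀ ≡ true → AnchoredBonds u a₀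
    bonds-of-Other uO a₀A ua₀ = anchored-bonds uO a₀A ua₀ (λ cO _ → Other-anchored cO)

    bonded-via : ∀ {u a c} → Other u → Anchor a → Unlinked a c → adj G u c ≡ false → mem B c a ≡ true
    bonded-via {a = a} {c} uO aA ac ¬uc =
      bond-sym (bond-if-adjacent ac (adj-sym G (anchor-adj aA (non-neighbour-Other′ uO ¬uc))))

    -- The vertex of G − B missed by both the anchor a and u is a non-neighbour of u (or a surplus appears).
    bonded-non-neighbour : ∀ {u a₀ a} → Other u → Anchor a₀ → mem B u a₀ ≡ true → Anchor a →
      (a₀ ≢ a → Unlinked a a₀ → ⊥) → (∃ λ c → adj G u c ≡ false × c ≢ u × mem B c a ≡ true) ⊎ Surplus
    bonded-non-neighbour {u} {a₀} {a} uO a₀A ua₀ aA excluded with non-neighbours u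
    ... | b₁ , b₂ , N with common-unlinked (Anchor≢Other aA uO)
    ... | c , c≢a , c≢u , ac , uc with unlinked-cases N (bonds-of-Other uO a₀A ua₀) c≢u uc
    ...   | inj₁ refl               = inj₁ (c , NonNeighbours.¬va N , c≢u , bonded-via uO aA ac (NonNeighbours.¬va N))
    ...   | inj₂ (inj₁ refl)        = inj₁ (c , NonNeighbours.¬vb N , c≢u , bonded-via uO aA ac (NonNeighbours.¬vb N))
    ...   | inj₂ (inj₂ (inj₁ refl)) = ⊥-elim (excluded c≢a ac)
    ...   | inj₂ (inj₂ (inj₂ s))    = inj₂ s

    surplus-from-unlinked-pair : ∀ {u u₁ u₂} → Other u → Other u₁ → Other u₂ → NonNeighbours G u u₁ u₂ →
      mem B u y ≡ true → mem B u₁ y ≡ true → mem B u₂ z ≡ true → adj G u₂ u₁ ≡ false → Surplus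
    surplus-from-unlinked-pair uO u₁O u₂O Nu uy u₁y u₂z ¬u₂u₁ with common-unlinked (Anchor≢Other z-Anchor u₂O)
    ... | d , d≢z , d≢u₂ , zd , u₂d
      with unlinked-cases (NonNeighbours-rotate Nu ¬u₂u₁) (bonds-of-Other u₂O z-Anchor u₂z) d≢u₂ u₂d
    ...   | inj₁ refl              =
      two-anchor-bonds uO  y-Anchor z-Anchor y≢z uy  (bond-if-adjacent (Unlinked-sym zd) (anchor-adj z-Anchor uO))
    ...   | inj₂ (inj₁ refl)       =
      two-anchor-bonds u₁O y-Anchor z-Anchor y≢z u₁y (bond-if-adjacent (Unlinked-sym zd) (anchor-adj z-Anchor u₁O))
    ...   | inj₂ (inj₂ (inj₁ d≡z)) = ⊥-elim (d≢z d≡z)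
    ...   | inj₂ (inj₂ (inj₂ s))   = s

    surplus-from-pair : ∀ {u u₁ u₂} → Other u → Other u₁ → Other u₂ → NonNeighbours G u u₁ u₂ →
      mem B u y ≡ true → mem B u₁ y ≡ true → mem B u₂ z ≡ true → Surplus
    surplus-from-pair uO u₁O u₂O Nu uy u₁y u₂z with common-unlinked (≢-sym (NonNeighbours.b≢v Nu))
    ... | c , c≢u , c≢u₂ , uc , u₂c with unlinked-cases Nu (bonds-of-Other uO y-Anchor uy) c≢u uc
    ...   | inj₂ (inj₁ c≡u₂)        = ⊥-elim (c≢u₂ c≡u₂)
    ...   | inj₂ (inj₂ (inj₂ s))    = s
    ...   | inj₂ (inj₂ (inj₁ refl)) =
      two-anchor-bonds u₂O z-Anchor y-Anchor (≢-sym y≢z) u₂z (bond-if-adjacent u₂c (anchor-adj y-Anchor u₂O))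
    ...   | inj₁ refl with u₂c
    ...     | inj₂ u₂u₁∈B = bonded-Others u₂O u₁O u₂u₁∈B (Other-anchored u₂O) (Other-anchored u₁O)
    ...     | inj₁ ¬u₂u₁  = surplus-from-unlinked-pair uO u₁O u₂O Nu uy u₁y u₂z ¬u₂u₁

    surplus : mem B z y ≡ false → Surplus
    surplus zy∉B with has-bond y
    ... | u , yu∈B with bond-classify y≢w yu∈B
    ... | inj₁ (inj₁ refl)        = ⊥-elim (bond⇒≢ yu∈B refl)
    ... | inj₁ (inj₂ (inj₁ refl)) = contradiction (bond-sym yu∈B) (λ zy∈B → contradiction (trans (sym zy∈B) zy∉B) λ ())
    ... | inj₁ (inj₂ (inj₂ refl)) = contradiction (trans (sym (sub B y u yu∈B)) (adj-sym G ¬wy)) λ ()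
    ... | inj₂ uO with bonded-non-neighbour uO y-Anchor uy y-Anchor (λ y≢y _ → y≢y refl)
                     | bonded-non-neighbour uO y-Anchor uy z-Anchor (λ _ → z-y-linked)
      where
      uy : mem B u y ≡ true
      uy = bond-sym yu∈B
      z-y-linked : Unlinked z y → ⊥
      z-y-linked (inj₁ ¬zy)  = neighbour≢non-neighbour G z-adj-y ¬zy refl
      z-y-linked (inj₂ zy∈B) = contradiction (trans (sym zy∈B) zy∉B) λ ()
    ... | inj₂ s | _      = s
    ... | inj₁ _ | inj₂ s = s
    ... | inj₁ (u₁ , ¬uu₁ , u₁≢u , u₁y) | inj₁ (u₂ , ¬uu₂ , u₂≢u , u₂z) with u₁ ≟ᶠ u₂
    ...   | yes refl = two-anchor-bonds (non-neighbour-Other′ uO ¬uu₁) y-Anchor z-Anchor y≢z u₁y u₂z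
    ...   | no u₁≢u₂ = surplus-from-pair uO (non-neighbour-Other′ uO ¬uu₁) (non-neighbour-Other′ uO ¬uu₂)
                         (record { a≢v = u₁≢u ; b≢v = u₂≢u ; a≢b = u₁≢u₂ ; ¬va = ¬uu₁ ; ¬vb = ¬uu₂ })
                         (bond-sym yu∈B) u₁y u₂z

    covered : ∀ i → 1 ≤ bondsBelow B ρ i ⊎ i ∈ y ∷ w ∷ z ∷ []
    covered i with classify i
    ... | inj₁ refl                  = inj₁ x-covered
    ... | inj₂ (inj₁ (inj₁ refl))        = inj₂ (here refl)
    ... | inj₂ (inj₁ (inj₂ (inj₁ refl))) = inj₂ (there (there (here refl)))
    ... | inj₂ (inj₁ (inj₂ (inj₂ refl))) = inj₂ (there (here refl))
    ... | inj₂ (inj₂ iO)                 = inj₁ (Other-covered iO (Other-anchored iO))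

    bound : n ∸ 2 ≤ card B
    bound with mem B z y in zy
    ... | false = let (e , 2≤e) = surplus zy in card-bound-surplus B ρ covered e 2≤e
    ... | true  = card-bound B ρ covered-but-z
      where
      covered-but-z : ∀ i → 1 ≤ bondsBelow B ρ i ⊎ i ∈ y ∷ w ∷ []
      covered-but-z i with covered i
      ... | inj₁ 1≤i                         = inj₁ 1≤i
      ... | inj₂ (here i≡y)                  = inj₂ (here i≡y)
      ... | inj₂ (there (here i≡w))          = inj₂ (there (here i≡w))
      ... | inj₂ (there (there (here refl))) = inj₁ (bondsBelow-≥1 B ρ ρy<ρz zy)

  module Case-q≢z (q≢z : q ≢ z) {t} (Nz : NonNeighbours G z x t) where
    open NonNeighbours Nz using () renaming (b≢v to t≢z; a≢b to x≢t; ¬vb to ¬zt)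

    t-Other : Other t
    t-Other = other (≢-sym x≢t) t≢y t≢z t≢w
      where
      t≢y : t ≢ y
      t≢y = ≢-sym (neighbour≢non-neighbour G z-adj-y ¬zt)
      t≢w : t ≢ w
      t≢w refl with non-neighbour-cases Nw z (adj-sym G ¬zt)
      ... | inj₁ z≡w        = z≢w z≡w
      ... | inj₂ (inj₁ z≡y) = y≢z (sym z≡y)
      ... | inj₂ (inj₂ z≡q) = q≢z (sym z≡q)

    q-Other : Other q
    q-Other = other q≢x (≢-sym y≢q) q≢z q≢w
      where
      q≢x : q ≢ x
      q≢x = ≢-sym (neighbour≢non-neighbour G (adj-sym G xw) ¬wq)

    z-adj : ∀ {u} → Other u → u ≢ t → adj G z u ≡ true
    z-adj (other u≢x _ u≢z _) u≢t = adjacent-unless Nz u≢z u≢x u≢t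

    rank : Fin n → ℕ
    rank i = if does (i ≟ᶠ q) then n + 3 else if does (i ≟ᶠ t) then n + 2 else baseRank i

    rank-q : rank q ≡ n + 3
    rank-q rewrite dec-true (q ≟ᶠ q) refl = refl

    rank-t : t ≢ q → rank t ≡ n + 2
    rank-t t≢q rewrite dec-false (t ≟ᶠ q) t≢q | dec-true (t ≟ᶠ t) refl = refl

    rank-base : ∀ {i} → i ≢ q → i ≢ t → rank i ≡ baseRank i
    rank-base {i} i≢q i≢t rewrite dec-false (i ≟ᶠ q) i≢q | dec-false (i ≟ᶠ t) i≢t = refl

    below-t : t ≢ q → ∀ {c} → c ≢ q → c ≢ t → rank c < rank t
    below-t t≢q {c} c≢q c≢t rewrite rank-base c≢q c≢t | rank-t t≢q =
      subst (baseRank c <_) (sym (+-suc n 1)) (s≤s (baseRank≤n+1 c))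

    rank≤n+2 : ∀ {c} → c ≢ q → rank c ≤ n + 2
    rank≤n+2 {c} c≢q = case c ≟ᶠ t of λ
      { (yes refl) → ≤-reflexive (rank-t c≢q)
      ; (no c≢t)   → ≤-trans (≤-reflexive (rank-base c≢q c≢t)) (≤-trans (baseRank≤n+1 c) (+-monoʳ-≤ n (n≤1+n 1))) }

    below-q : ∀ {c} → c ≢ q → rank c < rank q
    below-q {c} c≢q = subst (rank c <_) (trans (sym (+-suc n 2)) (sym rank-q)) (s≤s (rank≤n+2 c≢q))

    rank-distinct : ∀ {u c} → Other u → Other c → u ≢ c → rank u ≢ rank c
    rank-distinct {u} {c} uO cO u≢c = distinct (u ≟ᶠ q) (c ≟ᶠ q) (u ≟ᶠ t) (c ≟ᶠ t)
      where
      distinct : Dec (u ≡ q) → Dec (c ≡ q) → Dec (u ≡ t) → Dec (c ≡ t) → rank u ≢ rank c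
      distinct (yes refl) _          _          _          = ≢-sym (<⇒≢ (below-q (≢-sym u≢c)))
      distinct (no _)     (yes refl) _          _          = <⇒≢ (below-q u≢c)
      distinct (no u≢q)   (no c≢q)   (yes refl) _          = ≢-sym (<⇒≢ (below-t u≢q c≢q (≢-sym u≢c)))
      distinct (no u≢q)   (no c≢q)   (no _)     (yes refl) = <⇒≢ (below-t c≢q u≢q u≢c)
      distinct (no u≢q)   (no c≢q)   (no u≢t)   (no c≢t)   = λ eq → u≢c (Ranking.ρ-injective-Other baseRanking uO cO
                                                        (trans (sym (rank-base u≢q u≢t)) (trans eq (rank-base c≢q c≢t))))

    rank-Other : ∀ {u} → Other u → 2 ≤ rank u
    rank-Other {u} uO = by-cases (u ≟ᶠ q) (u ≟ᶠ t)
      where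
      by-cases : Dec (u ≡ q) → Dec (u ≡ t) → 2 ≤ rank u
      by-cases (yes refl) _          = subst (2 ≤_) (sym rank-q) (≤-trans (n≤1+n 2) (m≤n+m 3 n))
      by-cases (no u≢q)   (yes refl) = subst (2 ≤_) (sym (rank-t u≢q)) (m≤n+m 2 n)
      by-cases (no u≢q)   (no u≢t)   = subst (2 ≤_) (sym (rank-base u≢q u≢t)) (Ranking.ρ-Other baseRanking uO)

    ranking : Ranking
    ranking = record
      { ρ  = rank
      ; ρy = trans (rank-base (≢-sym (Other.≢y q-Other)) (≢-sym (Other.≢y t-Other))) (Ranking.ρy baseRanking)
      ; ρw = trans (rank-base (≢-sym q≢w) (≢-sym (Other.≢w t-Other))) (Ranking.ρw baseRanking)
      ; ρx = trans (rank-base (≢-sym (Other.≢x q-Other)) x≢t) (Ranking.ρx baseRanking)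
      ; ρz = trans (rank-base (≢-sym q≢z) (≢-sym t≢z)) (Ranking.ρz baseRanking)
      ; ρ-Other = rank-Other
      ; ρ-injective-Other = λ {u} {c} uO cO eq → decidable-stable (u ≟ᶠ c) (λ u≢c → rank-distinct uO cO u≢c eq)
      }

    open Ranked ranking

    z-adj-w : adj G z w ≡ true
    z-adj-w = adjacent-unless Nz (≢-sym z≢w) (≢-sym x≢w) (≢-sym (Other.≢w t-Other))

    z-covered : 1 ≤ bondsBelow B ρ z
    z-covered with common-unlinked (≢-sym z≢x)
    ... | c , c≢x , c≢z , xc , zc with unlinked-from-x c≢x xc
    ...   | inj₁ refl        = bondsBelow-≥1 B ρ ρy<ρz (bond-if-adjacent zc z-adj-y)
    ...   | inj₂ (inj₁ refl) = ⊥-elim (c≢z refl)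
    ...   | inj₂ (inj₂ refl) = bondsBelow-≥1 B ρ ρw<ρz (bond-if-adjacent zc z-adj-w)

    q-covered : 1 ≤ bondsBelow B ρ q
    q-covered with has-bond q
    ... | c , qc = bondsBelow-≥1 B ρ (below-q (≢-sym (bond⇒≢ qc))) qc

    Other-anchored : ∀ {u} → Other u → u ≢ q → u ≢ t → AnchorBond u
    Other-anchored uO u≢q u≢t = anchor-bond uO (z-adj uO u≢t) u≢q

    covered-but-t : ∀ i → 1 ≤ bondsBelow B ρ i ⊎ i ∈ y ∷ w ∷ t ∷ []
    covered-but-t i with classify i
    ... | inj₁ refl                      = inj₁ x-covered
    ... | inj₂ (inj₁ (inj₁ refl))        = inj₂ (here refl)
    ... | inj₂ (inj₁ (inj₂ (inj₁ refl))) = inj₁ z-covered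
    ... | inj₂ (inj₁ (inj₂ (inj₂ refl))) = inj₂ (there (here refl))
    ... | inj₂ (inj₂ iO)                 = Other-case iO (i ≟ᶠ q) (i ≟ᶠ t)
      where
      Other-case : Other i → Dec (i ≡ q) → Dec (i ≡ t) → 1 ≤ bondsBelow B ρ i ⊎ i ∈ y ∷ w ∷ t ∷ []
      Other-case _  (yes refl) _          = inj₁ q-covered
      Other-case _  (no _)     (yes i≡t)  = inj₂ (there (there (here i≡t)))
      Other-case iO (no i≢q)   (no i≢t)   = inj₁ (Other-covered iO (Other-anchored iO i≢q i≢t))

    covered-if-t : 1 ≤ bondsBelow B ρ t → ∀ i → 1 ≤ bondsBelow B ρ i ⊎ i ∈ y ∷ w ∷ []
    covered-if-t t-covered i with covered-but-t i
    ... | inj₁ 1≤i                         = inj₁ 1≤i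
    ... | inj₂ (here i≡y)                  = inj₂ (here i≡y)
    ... | inj₂ (there (here i≡w))          = inj₂ (there (here i≡w))
    ... | inj₂ (there (there (here refl))) = inj₁ t-covered

    module Isolated-pair (t≢q : t ≢ q) (only-tq : ∀ {c} → mem B t c ≡ true → c ≡ q)
                         (only-qt : ∀ {c} → mem B q c ≡ true → c ≡ t) where

      q≢t : q ≢ t
      q≢t = ≢-sym t≢q

      bonds-of-Other : ∀ {u a₀} → Other u → u ≢ q → u ≢ t → Anchor a₀ → mem B u a₀ ≡ true → AnchoredBonds u a₀
      bonds-of-Other uO u≢q u≢t a₀A ua₀ = anchored-bonds uO a₀A ua₀ λ cO uc →
        Other-anchored cO (λ { refl → u≢t (only-qt (bond-sym uc)) }) (λ { refl → u≢q (only-tq (bond-sym uc)) })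

      w-t-linked : Unlinked w t → ⊥
      w-t-linked (inj₁ ¬wt)  = neighbour≢non-neighbour G (w-adj t-Other t≢q) ¬wt refl
      w-t-linked (inj₂ wt∈B) = q≢w (sym (only-tq (bond-sym wt∈B)))

      z-q-linked : Unlinked z q → ⊥
      z-q-linked (inj₁ ¬zq)  = neighbour≢non-neighbour G (z-adj q-Other q≢t) ¬zq refl
      z-q-linked (inj₂ zq∈B) = Other.≢z t-Other (sym (only-qt (bond-sym zq∈B)))

      y-q-linked : Unlinked y q → ⊥
      y-q-linked (inj₁ ¬yq)  = neighbour≢non-neighbour G (y-adj q-Other) ¬yq refl
      y-q-linked (inj₂ yq∈B) = Other.≢y t-Other (sym (only-qt (bond-sym yq∈B)))

      r : Fin n
      r = proj₁ (other-non-neighbour (≢-sym q≢w) (adj-sym G ¬wq))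

      Nq : NonNeighbours G q w r
      Nq = proj₂ (other-non-neighbour (≢-sym q≢w) (adj-sym G ¬wq))

      s : Fin n
      s = proj₁ (other-non-neighbour (≢-sym (Other.≢z t-Other)) (adj-sym G ¬zt))

      Nt : NonNeighbours G t z s
      Nt = proj₂ (other-non-neighbour (≢-sym (Other.≢z t-Other)) (adj-sym G ¬zt))

      r-Other : Other r
      r-Other = let open NonNeighbours Nq in other
        (≢-sym (neighbour≢non-neighbour G (adj-sym G (x-adj q-Other)) ¬vb))
        (≢-sym (neighbour≢non-neighbour G (adj-sym G (y-adj q-Other)) ¬vb))
        (≢-sym (neighbour≢non-neighbour G (adj-sym G (z-adj q-Other q≢t)) ¬vb))
        (≢-sym a≢b)

      s-Other : Other s
      s-Other = let open NonNeighbours Nt in other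
        (≢-sym (neighbour≢non-neighbour G (adj-sym G (x-adj t-Other)) ¬vb))
        (≢-sym (neighbour≢non-neighbour G (adj-sym G (y-adj t-Other)) ¬vb))
        (≢-sym a≢b)
        (≢-sym (neighbour≢non-neighbour G (adj-sym G (w-adj t-Other t≢q)) ¬vb))

      wr∈B : mem B w r ≡ true
      wr∈B = bond-to-second-non-neighbour only-qt Nq w-t-linked (w-adj r-Other (NonNeighbours.b≢v Nq))

      zs∈B : mem B z s ≡ true
      zs∈B = bond-to-second-non-neighbour only-tq Nt z-q-linked (z-adj s-Other (NonNeighbours.b≢v Nt))

      r≢t : r ≢ t
      r≢t r≡t = q≢w (sym (only-tq (subst (λ v → mem B v w ≡ true) r≡t (bond-sym wr∈B))))

      s≢q : s ≢ q
      s≢q s≡q = Other.≢z t-Other (sym (only-qt (subst (λ v → mem B v z ≡ true) s≡q (bond-sym zs∈B))))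

      yz-or-surplus : mem B y z ≡ true ⊎ Surplus
      yz-or-surplus with common-unlinked (≢-sym (Other.≢y t-Other))
      ... | c , _ , c≢t , yc , inj₂ tc∈B = ⊥-elim (y-q-linked (subst (Unlinked y) (only-tq tc∈B) yc))
      ... | c , _ , c≢t , yc , inj₁ ¬tc with non-neighbour-cases Nt c ¬tc
      ...   | inj₁ c≡t         = ⊥-elim (c≢t c≡t)
      ...   | inj₂ (inj₁ refl) = inj₁ (bond-if-adjacent yc (adj-sym G z-adj-y))
      ...   | inj₂ (inj₂ refl) = inj₂ (two-anchor-bonds s-Other z-Anchor y-Anchor (≢-sym y≢z)
                                   (bond-sym zs∈B) (bond-sym (bond-if-adjacent yc (y-adj s-Other))))

      module Apart (zw∉B : mem B z w ≡ false) (r≢s : r ≢ s) where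

        r′ : Fin n
        r′ = proj₁ (other-non-neighbour (≢-sym (NonNeighbours.b≢v Nq)) (adj-sym G (NonNeighbours.¬vb Nq)))

        Nr : NonNeighbours G r q r′
        Nr = proj₂ (other-non-neighbour (≢-sym (NonNeighbours.b≢v Nq)) (adj-sym G (NonNeighbours.¬vb Nq)))

        s′ : Fin n
        s′ = proj₁ (other-non-neighbour (≢-sym (NonNeighbours.b≢v Nt)) (adj-sym G (NonNeighbours.¬vb Nt)))

        Ns : NonNeighbours G s t s′
        Ns = proj₂ (other-non-neighbour (≢-sym (NonNeighbours.b≢v Nt)) (adj-sym G (NonNeighbours.¬vb Nt)))

        bonds-of-r : AnchoredBonds r w
        bonds-of-r = bonds-of-Other r-Other (NonNeighbours.b≢v Nq) r≢t w-Anchor (bond-sym wr∈B)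

        bonds-of-s : AnchoredBonds s z
        bonds-of-s = bonds-of-Other s-Other s≢q (NonNeighbours.b≢v Nt) z-Anchor (bond-sym zs∈B)

        z-w-linked : Unlinked z w → ⊥
        z-w-linked (inj₁ ¬zw)  = neighbour≢non-neighbour G z-adj-w ¬zw refl
        z-w-linked (inj₂ zw∈B) = contradiction (trans (sym zw∈B) zw∉B) λ ()

        s-q-linked : Unlinked s q → ⊥
        s-q-linked (inj₁ ¬sq) with non-neighbour-cases Nq s (adj-sym G ¬sq)
        ... | inj₁ s≡q        = s≢q s≡q
        ... | inj₂ (inj₁ s≡w) = Other.≢w s-Other s≡w
        ... | inj₂ (inj₂ s≡r) = r≢s (sym s≡r)
        s-q-linked (inj₂ sq∈B) = NonNeighbours.b≢v Nt (only-qt (bond-sym sq∈B))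

        r′≢t : r′ ≢ t
        r′≢t r′≡t with non-neighbour-cases Nt r (adj-sym G (subst (λ v → adj G r v ≡ false) r′≡t (NonNeighbours.¬vb Nr)))
        ... | inj₁ r≡t        = r≢t r≡t
        ... | inj₂ (inj₁ r≡z) = Other.≢z r-Other r≡z
        ... | inj₂ (inj₂ r≡s) = r≢s r≡s

        r′≢x : r′ ≢ x
        r′≢x r′≡x = neighbour≢non-neighbour G (adj-sym G (x-adj r-Other)) (NonNeighbours.¬vb Nr) (sym r′≡x)

        zr′-or-surplus : (mem B z r′ ≡ true × r′ ≢ z) ⊎ Surplus
        zr′-or-surplus = unlinked-anchor-bond Nr bonds-of-r (≢-sym (Other.≢z r-Other)) z-q-linked z-w-linked
          λ ¬zr′ r′≢z → case non-neighbour-cases Nz r′ ¬zr′ of λ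
            { (inj₁ r′≡z) → r′≢z r′≡z ; (inj₂ (inj₁ r′≡x)) → r′≢x r′≡x
            ; (inj₂ (inj₂ r′≡t)) → r′≢t r′≡t }

        ws′-or-surplus : (mem B w s′ ≡ true × s′ ≢ w) ⊎ Surplus
        ws′-or-surplus = unlinked-anchor-bond Ns bonds-of-s (≢-sym (Other.≢w s-Other)) w-t-linked
          (z-w-linked ∘ Unlinked-sym)
          λ ¬ws′ s′≢w → case non-neighbour-cases Nw s′ ¬ws′ of λ
            { (inj₁ s′≡w)        → s′≢w s′≡w
            ; (inj₂ (inj₁ s′≡y)) → neighbour≢non-neighbour G (adj-sym G (y-adj s-Other)) (NonNeighbours.¬vb Ns) (sym s′≡y)
            ; (inj₂ (inj₂ s′≡q)) → s-q-linked (inj₁ (subst (λ v → adj G s v ≡ false) s′≡q (NonNeighbours.¬vb Ns))) }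

        surplus-from-bonds : mem B z r′ ≡ true → r′ ≢ z → mem B w s′ ≡ true → s′ ≢ w → Surplus
        surplus-from-bonds zr′ r′≢z ws′ s′≢w with common-unlinked r≢s
        ... | c , c≢r , c≢s , rc , sc with unlinked-cases Nr bonds-of-r c≢r rc
        ...   | inj₁ refl               = ⊥-elim (s-q-linked sc)
        ...   | inj₂ (inj₂ (inj₂ e))    = e
        ...   | inj₂ (inj₂ (inj₁ refl)) =
          two-anchor-bonds s-Other z-Anchor w-Anchor z≢w (bond-sym zs∈B)
            (bond-if-adjacent sc (adj-sym G (w-adj s-Other s≢q)))
        ...   | inj₂ (inj₁ refl) with unlinked-cases Ns bonds-of-s c≢s sc
        ...     | inj₁ r′≡t               = ⊥-elim (r′≢t r′≡t)
        ...     | inj₂ (inj₂ (inj₁ r′≡z)) = ⊥-elim (r′≢z r′≡z)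
        ...     | inj₂ (inj₂ (inj₂ e))    = e
        ...     | inj₂ (inj₁ r′≡s′)       =
          two-anchor-bonds r′-Other z-Anchor w-Anchor z≢w (bond-sym zr′) (bond-sym wr′)
          where
          wr′ : mem B w r′ ≡ true
          wr′ = subst (λ v → mem B w v ≡ true) (sym r′≡s′) ws′
          r′-Other : Other r′
          r′-Other = other r′≢x (neighbour≢non-neighbour G (sub B w r′ wr′) ¬wy) r′≢z (≢-sym (bond⇒≢ wr′))

        surplus : Surplus
        surplus with zr′-or-surplus | ws′-or-surplus
        ... | inj₂ e              | _                   = e
        ... | inj₁ _              | inj₂ e              = e
        ... | inj₁ (zr′ , r′≢z)   | inj₁ (ws′ , s′≢w)   = surplus-from-bonds zr′ r′≢z ws′ s′≢w

      surplus : Surplus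
      surplus with yz-or-surplus | mem B z w in zw
      ... | inj₂ e  | _     = e
      ... | inj₁ yz | true  = z , bondsBelow-≥2 B ρ y≢w ρy<ρz ρw<ρz (bond-sym yz) zw
      ... | inj₁ _  | false with r ≟ᶠ s
      ...   | yes r≡s = two-anchor-bonds r-Other w-Anchor z-Anchor (≢-sym z≢w)
                           (bond-sym wr∈B) (bond-sym (subst (λ v → mem B z v ≡ true) (sym r≡s) zs∈B))
      ...   | no  r≢s  = Apart.surplus zw r≢s

    bound-isolated-t : t ≢ q → (∀ {c} → mem B t c ≡ true → c ≡ q) → n ∸ 2 ≤ card B
    bound-isolated-t t≢q only-tq with any? (λ c → mem B q c ≟ᵇ true ×-dec ¬? (c ≟ᶠ t))
    ... | yes (c , qc , c≢t) =
      card-bound-surplus B ρ covered-but-t q (bondsBelow-≥2 B ρ (≢-sym c≢t) (below-q t≢q) (below-q (≢-sym (bond⇒≢ qc))) qt qc)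
      where
      qt : mem B q t ≡ true
      qt = let (d , td) = has-bond t in bond-sym (subst (λ v → mem B t v ≡ true) (only-tq td) td)
    ... | no no-other-bond-at-q =
      let (e , 2≤e) = Isolated-pair.surplus t≢q only-tq only-qt in card-bound-surplus B ρ covered-but-t e 2≤e
      where
      only-qt : ∀ {c} → mem B q c ≡ true → c ≡ t
      only-qt {c} qc = decidable-stable (c ≟ᶠ t) λ c≢t → no-other-bond-at-q (c , qc , c≢t)

    bound : n ∸ 2 ≤ card B
    bound with t ≟ᶠ q
    ... | yes refl = card-bound B ρ (covered-if-t q-covered)
    ... | no  t≢q with any? (λ c → mem B t c ≟ᵇ true ×-dec ¬? (c ≟ᶠ q))
    ...   | yes (c , tc , c≢q) = card-bound B ρ (covered-if-t (bondsBelow-≥1 B ρ (below-t t≢q c≢q (≢-sym (bond⇒≢ tc))) tc))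
    ...   | no  no-other-bond-at-t = bound-isolated-t t≢q only-tq
      where
      only-tq : ∀ {c} → mem B t c ≡ true → c ≡ q
      only-tq {c} tc = decidable-stable (c ≟ᶠ q) λ c≢q → no-other-bond-at-t (c , tc , c≢q)

  bound : n ∸ 2 ≤ card B
  bound with q ≟ᶠ z
  ... | yes q≡z = Case-q≡z.bound q≡z
  ... | no  q≢z = Case-q≢z.bound q≢z (proj₂ (other-non-neighbour (≢-sym z≢x) (adj-sym G ¬xz)))

lemma4p1 : (n : ℕ) → 7 ≤ n → (G : Graph n) → Regular G (n ∸ 3) → ¬ IsK333 G →
    (B : EdgeSet G) → IsRomanBondage G B →
    (x w y z p q : Fin n) → adj G x w ≡ true →
    y ≢ x → z ≢ x → y ≢ z → adj G x y ≡ false → adj G x z ≡ false →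
    (∀ v → v ≢ x → adj G x v ≡ false → (v ≡ y) ⊎ (v ≡ z)) →
    p ≢ w → q ≢ w → p ≢ q → adj G w p ≡ false → adj G w q ≡ false →
    (∀ v → v ≢ w → adj G w v ≡ false → (v ≡ p) ⊎ (v ≡ q)) →
    mem B x w ≡ true → (∀ v → mem B x v ≡ true → v ≡ w) →
    (y ≡ p) ⊎ (y ≡ q) ⊎ (z ≡ p) ⊎ (z ≡ q) →
    n ∸ 2 ≤ card B
lemma4p1 n 7≤n G regular _ B bondage x w y z p q xw y≢x z≢x y≢z ¬xy ¬xz _ p≢w q≢w p≢q ¬wp ¬wq _ xw∈B only-xw shared =
  from-shared shared
  where
  Nx : NonNeighbours G x y z
  Nx = record { a≢v = y≢x ; b≢v = z≢x ; a≢b = y≢z ; ¬va = ¬xy ; ¬vb = ¬xz }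

  Nw : NonNeighbours G w p q
  Nw = record { a≢v = p≢w ; b≢v = q≢w ; a≢b = p≢q ; ¬va = ¬wp ; ¬vb = ¬wq }

  bound : ∀ {a b c d} → NonNeighbours G x a b → NonNeighbours G w c d → a ≡ c → n ∸ 2 ≤ card B
  bound Nx′ Nw′ refl = Setting.bound G regular 7≤n B bondage xw Nx′ Nw′ xw∈B only-xw

  from-shared : (y ≡ p) ⊎ (y ≡ q) ⊎ (z ≡ p) ⊎ (z ≡ q) → n ∸ 2 ≤ card B
  from-shared (inj₁ y≡p)               = bound Nx Nw y≡p
  from-shared (inj₂ (inj₁ y≡q))        = bound Nx (NonNeighbours-swap Nw) y≡q
  from-shared (inj₂ (inj₂ (inj₁ z≡p))) = bound (NonNeighbours-swap Nx) Nw z≡p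
  from-shared (inj₂ (inj₂ (inj₂ z≡q))) = bound (NonNeighbours-swap Nx) (NonNeighbours-swap Nw) z≡q
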